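{- Let $G$ be a connected graph, let $\rho\ge r\ge 0$ be integers, and let $x_0$ be a vertex of $G$. The following are equivalent: (i) $\Delta_r(G)>\rho$; (ii) $p_r$ preserves $(\rho/2)$-balls; (iii) $\pi_1^r(G,x_0)\supseteq\pi_1^\rho(G,x_0)$; (iv) $p_r$ and $p_\rho$ are isomorphic as coverings of $G$. In particular, either $\Delta_r(G)=\infty$ and (i)–(iv) hold for every integer $\rho\ge r$, or $\Delta_r(G)-1$ is the maximum $\rho\ge r$ satisfying (i)–(iv).
   Context: Graphs are simple. Walks, reduction (iteratively replacing subwalks $ueveu$ by $u$), homotopy (equal reductions) and the combinatorial fundamental group $\pi_1(G,x_0)$ (homotopy classes of closed walks at $x_0$ under concatenation) are as usual. A closed walk $W$ at $x_0$ stems from a cycle $O$ if $W=W_0QW_0^-$ where $Q$ is a closed walk traversing every edge of $O$ exactly once. For an integer $r\ge0$, the $r$-local subgroup $\pi_1^r(G,x_0)$ is the subgroup generated by closed walks at $x_0$ stemming from cycles of length $\le r$. A covering is an epimorphism $p\colon C\to G$ that maps the edges at each vertex $v$ bijectively to the edges at $p(v)$; preimages are lifts. The $r$-local covering $p_r\colon G_r\to G$ is the covering (unique up to isomorphism, independent of $x_0$) such that $p_r$ induces an isomorphism $\pi_1(G_r,\hat x_0)\to\pi_1^r(G,x_0)$ for a lift $\hat x_0$ of $x_0$. The displacement is $\Delta_r(G)=\min\{\mathrm{dist}_{G_r}(\hat u,\hat v):\hat u\ne\hat v$ lifts of the same vertex of $G\}$, with $\min\emptyset=\infty$. The $(\rho/2)$-ball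 $B_G(v,\rho/2)$ is the subgraph formed by all vertices and edges traversed by closed walks at $v$ of length at most $\rho$; a covering $p\colon C\to G$ preserves $(\rho/2)$-balls if $p$ restricts to an isomorphism $B_C(v,\rho/2)\to B_G(p(v),\rho/2)$ for every vertex $v$ of $C$. -}

module Defs where

open import Data.Nat using (ℕ; zero; suc; _≤_; _<_; _∸_)
open import Data.List using (List; []; _∷_)
open import Data.List.Relation.Unary.Unique.Propositional using (Unique)
open import Data.List.Membership.Propositional using (_∈_)
open import Data.Product using (Σ; Σ-syntax; ∃; ∃-syntax; _×_; _,_)
open import Data.Sum using (_⊎_)
open import Relation.Nullary using (¬_)
open import Relation.Binary.PropositionalEquality using (_≡_; _≢_; subst)
open import Relation.Binary.Construct.Closure.ReflexiveTransitive using (Star)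

record Graph : Set₁ where
  field
    V      : Set
    Adj    : V → V → Set
    sym    : ∀ {u v} → Adj u v → Adj v u
    irrefl : ∀ {v} → ¬ Adj v v
    prop   : ∀ {u v} (a b : Adj u v) → a ≡ b

open Graph public

data Walk (G : Graph) : V G → V G → Set where
  nil  : ∀ {x} → Walk G x x
  cons : ∀ {x y z} → Adj G x y → Walk G y z → Walk G x z

module _ {G : Graph} where

  length : ∀ {x y} → Walk G x y → ℕ
  length nil        = zero
  length (cons _ W) = suc (length W)

  _++ʷ_ : ∀ {x y z} → Walk G x y → Walk G y z → Walk G x z
  nil      ++ʷ W' = W'
  cons a W ++ʷ W' = cons a (W ++ʷ W')

  infixr 5 _++ʷ_

  rev : ∀ {x y} → Walk G x y → Walk G y x
  rev nil        = nil
  rev (cons a W) = rev W ++ʷ cons (sym G a) nil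

  verts : ∀ {x y} → Walk G x y → List (V G)
  verts (nil {x})      = x ∷ []
  verts (cons {x} _ W) = x ∷ verts W

  after : ∀ {x y} → Walk G x y → List (V G)
  after nil        = []
  after (cons _ W) = verts W

  data Traverses {a b : V G} : ∀ {x y} → Walk G x y → Set where
    here⃗ : ∀ {z} (e : Adj G a b) (W : Walk G b z) → Traverses (cons e W)
    here⃖ : ∀ {z} (e : Adj G b a) (W : Walk G a z) → Traverses (cons e W)
    there : ∀ {x y z} (e : Adj G x y) {W : Walk G y z} → Traverses {a} {b} W → Traverses (cons e W)

  data Step : ∀ {x y} → Walk G x y → Walk G x y → Set where
    here  : ∀ {x v z} (a : Adj G x v) (b : Adj G v x) (W : Walk G x z) →
            Step (cons a (cons b W)) W
    there : ∀ {x y z} (a : Adj G x y) {W W' : Walk G y z} →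
            Step W W' → Step (cons a W) (cons a W')

  Reduced : ∀ {x y} → Walk G x y → Set
  Reduced W = ∀ W' → ¬ Step W W'

  ReductionOf : ∀ {x y} → Walk G x y → Walk G x y → Set
  ReductionOf W R = Star Step W R × Reduced R

  Homotopic : ∀ {x y} → Walk G x y → Walk G x y → Set
  Homotopic W W' = Σ[ R ∈ Walk G _ _ ] (ReductionOf W R × ReductionOf W' R)

  -- A closed walk Q traversing every edge of a cycle O of length k
  -- exactly once (and nothing else) is a closed walk of length k ≥ 3 whose
  -- vertices other than the repeated start/end are pairwise distinct.

  CycleWalk : ∀ {y} → Walk G y y → Set
  CycleWalk Q = 3 ≤ length Q × Unique (after Q)

  StemsFromCycle≤ : ℕ → ∀ {x0} → Walk G x0 x0 → Set
  StemsFromCycle≤ r {x0} W =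
    Σ[ y ∈ V G ] Σ[ W0 ∈ Walk G x0 y ] Σ[ Q ∈ Walk G y y ]
      (CycleWalk Q × length Q ≤ r × W ≡ W0 ++ʷ (Q ++ʷ rev W0))

  -- π₁^r(G,x0) as a set of closed walks (closed under homotopy): the
  -- subgroup generated by closed walks stemming from cycles of length ≤ r.

  data InLocal (r : ℕ) {x0 : V G} : Walk G x0 x0 → Set where
    gen  : ∀ {W} → StemsFromCycle≤ r W → InLocal r W
    unit : InLocal r nil
    mul  : ∀ {W W'} → InLocal r W → InLocal r W' → InLocal r (W ++ʷ W')
    inv  : ∀ {W} → InLocal r W → InLocal r (rev W)
    homot : ∀ {W W'} → Homotopic W W' → InLocal r W → InLocal r W'

Connected : Graph → Set
Connected G = ∀ (u v : V G) → Walk G u v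

record Covering (C G : Graph) : Set where
  field
    map       : V C → V G
    hom       : ∀ {u v} → Adj C u v → Adj G (map u) (map v)
    surjV     : ∀ w → Σ[ u ∈ V C ] map u ≡ w
    surjE     : ∀ {w w'} → Adj G w w' →
                Σ[ u ∈ V C ] Σ[ u' ∈ V C ] (Adj C u u' × map u ≡ w × map u' ≡ w')
    liftE     : ∀ v {w} → Adj G (map v) w → Σ[ u ∈ V C ] (Adj C v u × map u ≡ w)
    liftE-uniq : ∀ v {u u'} → Adj C v u → Adj C v u' → map u ≡ map u' → u ≡ u'

open Covering public

module _ {C G : Graph} (p : Covering C G) where

  mapW : ∀ {x y} → Walk C x y → Walk G (map p x) (map p y)
  mapW nil        = nil
  mapW (cons a W) = cons (hom p a) (mapW W)

  mapAt : ∀ {x0 x̂0} → map p x̂0 ≡ x0 → Walk C x̂0 x̂0 → Walk G x0 x0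
  mapAt eq W = subst (λ z → Walk G z z) eq (mapW W)

-- p is an r-local covering (with respect to base point x0): C is connected
-- and for some lift x̂0 of x0 the induced map π₁(C,x̂0) → π₁(G,x0) is
-- injective with image exactly π₁^r(G,x0).
IsLocalCovering : (r : ℕ) (G : Graph) (x0 : V G) (C : Graph) → Covering C G → Set
IsLocalCovering r G x0 C p =
  Connected C ×
  Σ[ x̂0 ∈ V C ] Σ[ eq ∈ map p x̂0 ≡ x0 ]
    ( (∀ (W W' : Walk C x̂0 x̂0) → Homotopic (mapAt p eq W) (mapAt p eq W') → Homotopic W W')
    × (∀ (W : Walk G x0 x0) → InLocal r W → Σ[ Ŵ ∈ Walk C x̂0 x̂0 ] Homotopic (mapAt p eq Ŵ) W)
    × (∀ (Ŵ : Walk C x̂0 x̂0) → InLocal r (mapAt p eq Ŵ)) )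

data ℕ∞ : Set where
  fin : ℕ → ℕ∞
  ∞   : ℕ∞

module _ {C G : Graph} (p : Covering C G) where

  -- Δ = d  (Δ = min of dist over pairs of distinct lifts of a common vertex,
  -- min ∅ = ∞)
  DisplacementIs : ℕ∞ → Set
  DisplacementIs ∞ = ∀ (u v : V C) → map p u ≡ map p v → u ≡ v
  DisplacementIs (fin n) =
    (Σ[ u ∈ V C ] Σ[ v ∈ V C ] (map p u ≡ map p v × u ≢ v ×
       Σ[ W ∈ Walk C u v ] length W ≡ n))
    × (∀ (u v : V C) → map p u ≡ map p v → u ≢ v → (W : Walk C u v) → n ≤ length W)

  DisplacementGt : ℕ → Set
  DisplacementGt ρ =
    ∀ (u v : V C) → map p u ≡ map p v → u ≢ v → (W : Walk C u v) → ρ < length W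

-- Balls:  B_G(v, ρ/2)

module _ (G : Graph) where

  InBallV : V G → ℕ → V G → Set
  InBallV v ρ u = Σ[ W ∈ Walk G v v ] (length W ≤ ρ × u ∈ verts W)

  InBallE : V G → ℕ → V G → V G → Set
  InBallE v ρ a b = Σ[ W ∈ Walk G v v ] (length W ≤ ρ × Traverses {a = a} {b = b} W)

-- p restricts to an isomorphism B_C(v,ρ/2) → B_G(p v,ρ/2) for every v
PreservesBalls : {C G : Graph} → Covering C G → ℕ → Set
PreservesBalls {C} {G} p ρ = ∀ (v : V C) →
    (∀ u → InBallV C v ρ u → InBallV G (map p v) ρ (map p u))
  × (∀ a b → InBallE C v ρ a b → InBallE G (map p v) ρ (map p a) (map p b))
  × (∀ u u' → InBallV C v ρ u → InBallV C v ρ u' → map p u ≡ map p u' → u ≡ u')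
  × (∀ w → InBallV G (map p v) ρ w → Σ[ u ∈ V C ] (InBallV C v ρ u × map p u ≡ w))
  × (∀ a' b' → InBallE G (map p v) ρ a' b' →
       Σ[ a ∈ V C ] Σ[ b ∈ V C ] (InBallE C v ρ a b × map p a ≡ a' × map p b ≡ b'))

IsoCoverings : {C D G : Graph} → Covering C G → Covering D G → Set
IsoCoverings {C} {D} p q =
  Σ[ φ ∈ (V C → V D) ] Σ[ ψ ∈ (V D → V C) ]
    ( (∀ u → ψ (φ u) ≡ u) × (∀ w → φ (ψ w) ≡ w)
    × (∀ {u v} → Adj C u v → Adj D (φ u) (φ v))
    × (∀ {u v} → Adj D (φ u) (φ v) → Adj C u v)
    × (∀ u → map q (φ u) ≡ map p u) )

module _ {G : Graph} (x0 : V G) (r : ℕ) {Cr : Graph} (pr : Covering Cr G) where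

  Cond-i : ℕ → Set
  Cond-i ρ = DisplacementGt pr ρ

  Cond-ii : ℕ → Set
  Cond-ii ρ = PreservesBalls pr ρ

  Cond-iii : ℕ → Set
  Cond-iii ρ = ∀ (W : Walk G x0 x0) → InLocal ρ W → InLocal r W

  Cond-iv : ℕ → {Cρ : Graph} → Covering Cρ G → Set
  Cond-iv ρ pρ = IsoCoverings pr pρ

  AllHold : ℕ → Set₁
  AllHold ρ = Cond-i ρ × Cond-ii ρ × Cond-iii ρ ×
    (∀ (Cρ : Graph) (pρ : Covering Cρ G) → IsLocalCovering ρ G x0 Cρ pρ → Cond-iv ρ pρ)

-- Everything is read off from lifting walks.  For an r-local covering with base point x̂0 over x0, a
-- closed walk at x0 lies in π₁^r exactly when its lift at x̂0 closes.  Any closed walk M of length ≤ ρ,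
-- conjugated by any walk, lies in π₁^ρ: cut out closed subwalks until a cycle or a backtrack remains.
-- Hence Δ_r > ρ says precisely that all of π₁^ρ lifts to closed walks, i.e. π₁^ρ ⊆ π₁^r; balls of radius
-- ρ/2 are spanned by closed walks of length ≤ ρ, which then lift isomorphically; and two connected
-- coverings whose lifts close along the same walks are isomorphic by transporting endpoints of lifts.
-- Δ_r itself is the least length of a walk joining distinct lifts of a vertex, and exceeds r.

module Submission where

open import Defs
open import Level using (0ℓ)
open import Axiom.ExcludedMiddle using (ExcludedMiddle)
open import Data.Nat using (ℕ; suc; _+_; _≤_; _<_; _∸_; z≤n; s≤s)
open import Data.Nat.Properties
  using (≤-refl; ≤-trans; ≤-<-trans; <-trans; <⇒≤; ≤-total; ≰⇒>; <⇒≱; ≮⇒≥;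
         m≤m+n; m≤n+m; m<n+m; +-monoʳ-<; +-mono-≤; +-comm; n<1+n)
open import Data.Nat.Induction using (<-wellFounded)
open import Induction.WellFounded using (Acc; acc)
open import Data.Product using (Σ; Σ-syntax; _×_; _,_; proj₁; proj₂)
open import Data.Sum using (_⊎_; inj₁; inj₂)
import Data.Sum as Sum
open import Data.Empty using (⊥-elim)
open import Data.List.Relation.Unary.Any using (here; there)
open import Data.List.Relation.Unary.All using ([])
open import Data.List.Relation.Unary.AllPairs using ([]; _∷_)
open import Data.List.Relation.Unary.All.Properties.Core using (¬Any⇒All¬)
open import Data.List.Relation.Unary.Unique.Propositional using (Unique)
open import Data.List.Membership.Propositional using (_∈_)
open import Function using (_∘_)
open import Function.Bundles using (_⇔_; mk⇔; Equivalence)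
import Function.Properties.Equivalence as ⇔
open import Relation.Nullary using (¬_; yes; no)
open import Relation.Binary.PropositionalEquality as ≡
  using (_≡_; _≢_; refl; cong; trans; subst; subst₂; module ≡-Reasoning)
open import Relation.Binary.Construct.Closure.ReflexiveTransitive using (Star; ε; _◅_; _◅◅_)

module _ {G : Graph} where

  private variable
    a b c d x y z : V G

  ++-assoc : (A : Walk G a b) (B : Walk G b c) (C : Walk G c d) →
             (A ++ʷ B) ++ʷ C ≡ A ++ʷ B ++ʷ C
  ++-assoc nil        B C = refl
  ++-assoc (cons e A) B C = cong (cons e) (++-assoc A B C)

  ++-identityʳ : (A : Walk G a b) → A ++ʷ nil ≡ A
  ++-identityʳ nil        = refl
  ++-identityʳ (cons e A) = cong (cons e) (++-identityʳ A)

  length-++ : (A : Walk G a b) (B : Walk G b c) → length (A ++ʷ B) ≡ length A + length B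
  length-++ nil        B = refl
  length-++ (cons e A) B = cong suc (length-++ A B)

  rev-++ : (A : Walk G a b) (B : Walk G b c) → rev (A ++ʷ B) ≡ rev B ++ʷ rev A
  rev-++ nil        B = ≡.sym (++-identityʳ (rev B))
  rev-++ (cons e A) B rewrite rev-++ A B = ++-assoc (rev B) (rev A) _

  rev-involutive : (A : Walk G a b) → rev (rev A) ≡ A
  rev-involutive nil        = refl
  rev-involutive (cons e A) rewrite rev-++ (rev A) (cons (sym G e) nil) | rev-involutive A =
    cong (λ e′ → cons e′ A) (prop G _ _)

  length-rev : (A : Walk G a b) → length (rev A) ≡ length A
  length-rev nil = refl
  length-rev (cons e A) rewrite length-++ (rev A) (cons (sym G e) nil) | length-rev A =
    +-comm (length A) 1

  length-middle : (P : Walk G a b) (D : Walk G b c) (S : Walk G c d) →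
                  length D ≤ length (P ++ʷ D ++ʷ S)
  length-middle P D S rewrite length-++ P (D ++ʷ S) | length-++ D S =
    ≤-trans (m≤m+n (length D) (length S)) (m≤n+m _ (length P))

  length-drop-middle : (P : Walk G a b) (D : Walk G b b) (S : Walk G b c) →
                       0 < length D → length (P ++ʷ S) < length (P ++ʷ D ++ʷ S)
  length-drop-middle P D S 0<D rewrite length-++ P (D ++ʷ S) | length-++ D S | length-++ P S =
    +-monoʳ-< (length P) (m<n+m (length S) 0<D)

  infix 4 _↠_

  _↠_ : Walk G x y → Walk G x y → Set
  _↠_ = Star Step

  ↠-prefix : (Q : Walk G a b) {W W′ : Walk G b c} → W ↠ W′ → Q ++ʷ W ↠ Q ++ʷ W′
  ↠-prefix Q ε        = ε
  ↠-prefix Q (s ◅ ss) = prefix Q s ◅ ↠-prefix Q ss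
    where
    prefix : (Q : Walk G a b) {W W′ : Walk G b c} → Step W W′ → Step (Q ++ʷ W) (Q ++ʷ W′)
    prefix nil        s = s
    prefix (cons e Q) s = there e (prefix Q s)

  rev-++-cancel : (Q : Walk G a b) (Z : Walk G b c) → rev Q ++ʷ Q ++ʷ Z ↠ Z
  rev-++-cancel nil        Z = ε
  rev-++-cancel (cons e Q) Z rewrite ++-assoc (rev Q) (cons (sym G e) nil) (cons e (Q ++ʷ Z)) =
    ↠-prefix (rev Q) (here (sym G e) e (Q ++ʷ Z) ◅ ε) ◅◅ rev-++-cancel Q Z

  ++-rev-cancel : (Q : Walk G a b) (Z : Walk G a c) → Q ++ʷ rev Q ++ʷ Z ↠ Z
  ++-rev-cancel nil        Z = ε
  ++-rev-cancel (cons e Q) Z rewrite ++-assoc (rev Q) (cons (sym G e) nil) Z =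
    ↠-prefix (cons e nil) (++-rev-cancel Q (cons (sym G e) Z)) ◅◅ here e (sym G e) Z ◅ ε

  ++-rev↠nil : (Q : Walk G a b) → Q ++ʷ rev Q ↠ nil
  ++-rev↠nil Q = subst (λ R → Q ++ʷ R ↠ nil) (++-identityʳ (rev Q)) (++-rev-cancel Q nil)

  Step-shortens : {W W′ : Walk G x y} → Step W W′ → length W′ < length W
  Step-shortens (here _ _ W) = <-trans (n<1+n (length W)) (n<1+n (suc (length W)))
  Step-shortens (there _ s)  = s≤s (Step-shortens s)

  homotopic-sym : {W W′ : Walk G x y} → Homotopic W W′ → Homotopic W′ W
  homotopic-sym (R , W↠R , W′↠R) = R , W′↠R , W↠R

  module _ (lem : ExcludedMiddle 0ℓ) where

    reduction : (W : Walk G x y) → Σ[ R ∈ Walk G x y ] ReductionOf W R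
    reduction W = go W (<-wellFounded (length W))
      where
      go : (W : Walk G x y) → Acc _<_ (length W) → Σ[ R ∈ Walk G x y ] ReductionOf W R
      go W (acc shorter) with lem {Σ (Walk G _ _) (Step W)}
      ... | no irreducible = W , ε , λ W′ s → irreducible (W′ , s)
      ... | yes (W′ , s) with go W′ (shorter (Step-shortens s))
      ...   | R , W′↠R , R-reduced = R , s ◅ W′↠R , R-reduced

    ↠⇒homotopic : {W W′ : Walk G x y} → W ↠ W′ → Homotopic W W′
    ↠⇒homotopic {W′ = W′} W↠W′ with reduction W′
    ... | R , W′↠R , R-reduced = R , (W↠W′ ◅◅ W′↠R , R-reduced) , (W′↠R , R-reduced)

  ∈-verts⇒split : (W : Walk G a b) → z ∈ verts W → Σ[ P ∈ Walk G a z ] Σ[ S ∈ Walk G z b ] W ≡ P ++ʷ S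
  ∈-verts⇒split nil        (here refl) = nil , nil , refl
  ∈-verts⇒split (cons e W) (here refl) = nil , cons e W , refl
  ∈-verts⇒split (cons e W) (there z∈W) with ∈-verts⇒split W z∈W
  ... | P , S , refl = cons e P , S , refl

  HasClosedSubwalk : Walk G a b → Set
  HasClosedSubwalk {a} {b} T =
    Σ[ z ∈ V G ] Σ[ P ∈ Walk G a z ] Σ[ D ∈ Walk G z z ] Σ[ S ∈ Walk G z b ]
      (T ≡ P ++ʷ D ++ʷ S × 0 < length D)

  ¬HasClosedSubwalk⇒Unique : (T : Walk G a b) → ¬ HasClosedSubwalk T → Unique (verts T)
  ¬HasClosedSubwalk⇒Unique nil        _        = [] ∷ []
  ¬HasClosedSubwalk⇒Unique (cons e T) no-cycle =
    ¬Any⇒All¬ (verts T) head-not-revisited ∷ ¬HasClosedSubwalk⇒Unique T (no-cycle ∘ extend)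
    where
    extend : HasClosedSubwalk T → HasClosedSubwalk (cons e T)
    extend (z , P , D , S , refl , 0<D) = z , cons e P , D , S , refl , 0<D
    head-not-revisited : ¬ (_ ∈ verts T)
    head-not-revisited a∈T with ∈-verts⇒split T a∈T
    ... | P , S , T≡PS = no-cycle (_ , nil , cons e P , S , cong (cons e) T≡PS , s≤s z≤n)

InLocal-mono : ∀ {G : Graph} {k ρ x0} {W : Walk G x0 x0} → k ≤ ρ → InLocal k W → InLocal ρ W
InLocal-mono k≤ρ (gen (y , W0 , Q , cycle , Q≤k , refl)) = gen (y , W0 , Q , cycle , ≤-trans Q≤k k≤ρ , refl)
InLocal-mono k≤ρ unit                                    = unit
InLocal-mono k≤ρ (mul i j)                               = mul (InLocal-mono k≤ρ i) (InLocal-mono k≤ρ j)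
InLocal-mono k≤ρ (inv i)                                 = inv (InLocal-mono k≤ρ i)
InLocal-mono k≤ρ (homot h i)                             = homot h (InLocal-mono k≤ρ i)

module _ (lem : ExcludedMiddle 0ℓ) {G : Graph} {k : ℕ} where

  private variable
    x0 y z : V G

  InLocal-↠ : {W W′ : Walk G x0 x0} → W ↠ W′ → InLocal k W → InLocal k W′
  InLocal-↠ W↠W′ = homot (↠⇒homotopic lem W↠W′)

  InLocal-↞ : {W W′ : Walk G x0 x0} → W ↠ W′ → InLocal k W′ → InLocal k W
  InLocal-↞ W↠W′ = homot (homotopic-sym (↠⇒homotopic lem W↠W′))

  InLocal-insert : (A : Walk G x0 y) (P : Walk G y z) (D : Walk G z z) (S : Walk G z y) →
    InLocal k ((A ++ʷ P) ++ʷ D ++ʷ rev (A ++ʷ P)) → InLocal k (A ++ʷ (P ++ʷ S) ++ʷ rev A) →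
    InLocal k (A ++ʷ (P ++ʷ D ++ʷ S) ++ʷ rev A)
  InLocal-insert A P D S i j =
    subst (InLocal k) (≡.sym reassociate-result)
      (InLocal-↠ (↠-prefix A (↠-prefix P (↠-prefix D
                    (↠-prefix (rev P) (rev-++-cancel A (P ++ʷ S ++ʷ rev A))
                     ◅◅ rev-++-cancel P (S ++ʷ rev A)))))
        (subst (InLocal k) reassociate-product (mul i j)))
    where
    reassociate-product :
      ((A ++ʷ P) ++ʷ D ++ʷ rev (A ++ʷ P)) ++ʷ A ++ʷ (P ++ʷ S) ++ʷ rev A
        ≡ A ++ʷ P ++ʷ D ++ʷ rev P ++ʷ rev A ++ʷ A ++ʷ P ++ʷ S ++ʷ rev A
    reassociate-product
      rewrite rev-++ A P | ++-assoc P S (rev A) | ++-assoc A P (D ++ʷ rev P ++ʷ rev A)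
            | ++-assoc A (P ++ʷ D ++ʷ rev P ++ʷ rev A) (A ++ʷ P ++ʷ S ++ʷ rev A)
            | ++-assoc P (D ++ʷ rev P ++ʷ rev A) (A ++ʷ P ++ʷ S ++ʷ rev A)
            | ++-assoc D (rev P ++ʷ rev A) (A ++ʷ P ++ʷ S ++ʷ rev A)
            | ++-assoc (rev P) (rev A) (A ++ʷ P ++ʷ S ++ʷ rev A) = refl
    reassociate-result : A ++ʷ (P ++ʷ D ++ʷ S) ++ʷ rev A ≡ A ++ʷ P ++ʷ D ++ʷ S ++ʷ rev A
    reassociate-result rewrite ++-assoc P (D ++ʷ S) (rev A) | ++-assoc D S (rev A) = refl

  -- If M = a P D S with D a nonempty closed subwalk, A M A⁻ is homotopic to the product of the shorter
  -- conjugates (A a P) D (A a P)⁻ and A (a P S) A⁻; otherwise M is a backtrack or a cycle.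
  conjugate-InLocal : (M : Walk G y y) → length M ≤ k → (A : Walk G x0 y) → InLocal k (A ++ʷ M ++ʷ rev A)
  conjugate-InLocal M = go M (<-wellFounded (length M))
    where
    go : (M : Walk G y y) → Acc _<_ (length M) → length M ≤ k →
         (A : Walk G x0 y) → InLocal k (A ++ʷ M ++ʷ rev A)
    go nil _ _ A = InLocal-↞ (++-rev↠nil A) unit
    go (cons a T) (acc shorter) M≤k A with lem {HasClosedSubwalk T}
    ... | yes (_ , P , D , S , refl , 0<D) =
      InLocal-insert A (cons a P) D S
        (go D (shorter D<M) (≤-trans (<⇒≤ D<M) M≤k) (A ++ʷ cons a P))
        (go (cons a P ++ʷ S) (shorter PS<M) (≤-trans (<⇒≤ PS<M) M≤k) A)
      where
      D<M : length D < length (cons a (P ++ʷ D ++ʷ S))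
      D<M = s≤s (length-middle P D S)
      PS<M : length (cons a P ++ʷ S) < length (cons a (P ++ʷ D ++ʷ S))
      PS<M = s≤s (length-drop-middle P D S 0<D)
    go (cons a nil)          _ _ _ | no _ = ⊥-elim (irrefl G a)
    go (cons a (cons b nil)) _ _ A | no _ =
      InLocal-↞ (↠-prefix A (here a b (rev A) ◅ ε) ◅◅ ++-rev↠nil A) unit
    go (cons a T@(cons _ (cons _ _))) _ M≤k A | no no-cycle =
      gen (_ , A , cons a T , (s≤s (s≤s (s≤s z≤n)) , ¬HasClosedSubwalk⇒Unique T no-cycle) , M≤k , refl)

module _ {C G : Graph} (p : Covering C G) where

  private variable
    u v w : V C
    x y z : V G

  edge-lift : (v : V C) → Adj G (map p v) y → V C
  edge-lift v a = proj₁ (liftE p v a)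

  edge-lift-adj : (a : Adj G (map p v) y) → Adj C v (edge-lift v a)
  edge-lift-adj {v} a = proj₁ (proj₂ (liftE p v a))

  edge-lift-over : (a : Adj G (map p v) y) → map p (edge-lift v a) ≡ y
  edge-lift-over {v} a = proj₂ (proj₂ (liftE p v a))

  edge-lift-unique : (a : Adj G (map p v) y) → Adj C v u → map p u ≡ y → edge-lift v a ≡ u
  edge-lift-unique {v} a b u-over = liftE-uniq p v (edge-lift-adj a) b (trans (edge-lift-over a) (≡.sym u-over))

  -- The lift of M starts at v; e lets M start at a vertex only propositionally equal to p v.
  endpoint : (v : V C) → map p v ≡ x → Walk G x y → V C
  endpoint v _    nil        = v
  endpoint v refl (cons a M) = endpoint (edge-lift v a) (edge-lift-over a) M

  endpoint-over : (v : V C) (e : map p v ≡ x) (M : Walk G x y) → map p (endpoint v e M) ≡ y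
  endpoint-over v e    nil        = e
  endpoint-over v refl (cons a M) = endpoint-over _ _ M

  lift : (v : V C) (e : map p v ≡ x) (M : Walk G x y) → Walk C v (endpoint v e M)
  lift v _    nil        = nil
  lift v refl (cons a M) = cons (edge-lift-adj a) (lift _ _ M)

  length-lift : (v : V C) (e : map p v ≡ x) (M : Walk G x y) → length (lift v e M) ≡ length M
  length-lift v _    nil        = refl
  length-lift v refl (cons a M) = cong suc (length-lift _ _ M)

  mapW-lift : (v : V C) (e : map p v ≡ x) (M : Walk G x y) →
              subst₂ (Walk G) e (endpoint-over v e M) (mapW p (lift v e M)) ≡ M
  mapW-lift v refl nil        = refl
  mapW-lift v refl (cons a M) =
    mapW-cons (edge-lift-adj a) (edge-lift-over a) (endpoint-over _ _ M) (mapW-lift _ _ M)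
    where
    mapW-cons : ∀ {u w} {y₁ y} {a : Adj G (map p v) y₁} {M : Walk G y₁ y} {Ŵ : Walk C u w}
      (b : Adj C v u) (e : map p u ≡ y₁) (e′ : map p w ≡ y) →
      subst₂ (Walk G) e e′ (mapW p Ŵ) ≡ M → subst₂ (Walk G) refl e′ (mapW p (cons b Ŵ)) ≡ cons a M
    mapW-cons b refl refl refl = cong (λ a′ → cons a′ _) (prop G _ _)

  LiftCloses : (v : V C) → map p v ≡ x → Walk G x x → Set
  LiftCloses v e M = endpoint v e M ≡ v

  closed-lift : (v : V C) (M : Walk G (map p v) (map p v)) → LiftCloses v refl M →
                Σ[ Ŵ ∈ Walk C v v ] mapW p Ŵ ≡ M
  closed-lift v M closes = close (lift v refl M) (endpoint-over v refl M) closes (mapW-lift v refl M)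
    where
    close : (Ŵ : Walk C v w) (e : map p w ≡ map p v) → w ≡ v →
            subst₂ (Walk G) refl e (mapW p Ŵ) ≡ M → Σ[ Ŵ ∈ Walk C v v ] mapW p Ŵ ≡ M
    close Ŵ refl refl over = Ŵ , over

  endpoint-cong : v ≡ w → (e : map p v ≡ x) (e′ : map p w ≡ x) (M : Walk G x y) →
                  endpoint v e M ≡ endpoint w e′ M
  endpoint-cong refl refl refl M = refl

  endpoint-subst : (e : map p v ≡ x) (h : y ≡ z) (M : Walk G x y) →
                   endpoint v e (subst (Walk G x) h M) ≡ endpoint v e M
  endpoint-subst e refl M = refl

  endpoint-mapW : (Ŵ : Walk C v w) → endpoint v refl (mapW p Ŵ) ≡ w
  endpoint-mapW nil        = refl
  endpoint-mapW (cons b Ŵ) =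
    trans (endpoint-cong (edge-lift-unique (hom p b) b refl) _ refl (mapW p Ŵ)) (endpoint-mapW Ŵ)

  endpoint-++ : (v : V C) (e : map p v ≡ x) (M : Walk G x y) (N : Walk G y z) →
                endpoint v e (M ++ʷ N) ≡ endpoint (endpoint v e M) (endpoint-over v e M) N
  endpoint-++ v _    nil        N = refl
  endpoint-++ v refl (cons a M) N = endpoint-++ _ _ M N

  endpoint-edge-adj : (v : V C) (e : map p v ≡ x) (a : Adj G x y) → Adj C v (endpoint v e (cons a nil))
  endpoint-edge-adj v refl a = edge-lift-adj a

  endpoint-edge-unique : (v : V C) (e : map p v ≡ x) (a : Adj G x y) →
                         Adj C v u → map p u ≡ y → endpoint v e (cons a nil) ≡ u
  endpoint-edge-unique v refl a = edge-lift-unique a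

  endpoint-rev : (v : V C) (e : map p v ≡ x) (M : Walk G x y) →
                 endpoint (endpoint v e M) (endpoint-over v e M) (rev M) ≡ v
  endpoint-rev v refl nil        = refl
  endpoint-rev v refl (cons a M) =
    let u  = edge-lift v a
        w  = endpoint u (edge-lift-over a) M
        ew = endpoint-over u (edge-lift-over a) M
    in trans (endpoint-++ w ew (rev M) (cons (sym G a) nil))
       (trans (endpoint-cong (endpoint-rev u (edge-lift-over a) M)
                             (endpoint-over w ew (rev M)) (edge-lift-over a) (cons (sym G a) nil))
              (endpoint-edge-unique u (edge-lift-over a) (sym G a) (sym C (edge-lift-adj a)) refl))

  endpoint-rev⁻¹ : (N : Walk G x y) (e : map p w ≡ y) (e′ : map p v ≡ x) →
                   endpoint w e (rev N) ≡ v → endpoint v e′ N ≡ w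
  endpoint-rev⁻¹ {w = w} N e e′ back =
    let v′ = endpoint w e (rev N)
        e″ = endpoint-over w e (rev N)
    in trans (endpoint-cong (≡.sym back) e′ e″ N)
             (subst (λ N′ → endpoint v′ e″ N′ ≡ w) (rev-involutive N) (endpoint-rev w e (rev N)))

  endpoint-≡⇔LiftCloses : (v : V C) (e : map p v ≡ x) (M N : Walk G x y) →
                          endpoint v e M ≡ endpoint v e N ⇔ LiftCloses v e (M ++ʷ rev N)
  endpoint-≡⇔LiftCloses v e M N = mk⇔ to from
    where
    to : endpoint v e M ≡ endpoint v e N → LiftCloses v e (M ++ʷ rev N)
    to same = trans (endpoint-++ v e M (rev N))
                    (trans (endpoint-cong same _ (endpoint-over v e N) (rev N)) (endpoint-rev v e N))
    from : LiftCloses v e (M ++ʷ rev N) → endpoint v e M ≡ endpoint v e N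
    from closes = ≡.sym (endpoint-rev⁻¹ N (endpoint-over v e M) e
                                        (trans (≡.sym (endpoint-++ v e M (rev N))) closes))

  LiftCloses-conjugate : (v : V C) (e : map p v ≡ x) (A : Walk G x y) (M : Walk G y y) →
    LiftCloses v e (A ++ʷ M ++ʷ rev A) ⇔ LiftCloses (endpoint v e A) (endpoint-over v e A) M
  LiftCloses-conjugate {y = y} v e A M = mk⇔ to from
    where
    ŷ : V C
    ŷ = endpoint v e A
    ŷ-over : map p ŷ ≡ y
    ŷ-over = endpoint-over v e A
    unfold : endpoint v e (A ++ʷ M ++ʷ rev A)
           ≡ endpoint (endpoint ŷ ŷ-over M) (endpoint-over ŷ ŷ-over M) (rev A)
    unfold = trans (endpoint-++ v e A (M ++ʷ rev A)) (endpoint-++ ŷ ŷ-over M (rev A))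
    to : LiftCloses v e (A ++ʷ M ++ʷ rev A) → LiftCloses ŷ ŷ-over M
    to closes = ≡.sym (endpoint-rev⁻¹ A (endpoint-over ŷ ŷ-over M) e (trans (≡.sym unfold) closes))
    from : LiftCloses ŷ ŷ-over M → LiftCloses v e (A ++ʷ M ++ʷ rev A)
    from closes = trans unfold (trans (endpoint-cong closes _ ŷ-over (rev A)) (endpoint-rev v e A))

  endpoint-Step : (v : V C) (e : map p v ≡ x) {M M′ : Walk G x y} → Step M M′ → endpoint v e M ≡ endpoint v e M′
  endpoint-Step v refl (here a b W) =
    let u = edge-lift v a
    in trans (endpoint-++ u (edge-lift-over a) (cons b nil) W)
             (endpoint-cong (endpoint-edge-unique u (edge-lift-over a) b (sym C (edge-lift-adj a)) refl)
                            _ refl W)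
  endpoint-Step v refl (there a s) = endpoint-Step _ _ s

  endpoint-↠ : (v : V C) (e : map p v ≡ x) {M M′ : Walk G x y} → M ↠ M′ → endpoint v e M ≡ endpoint v e M′
  endpoint-↠ v e ε        = refl
  endpoint-↠ v e (s ◅ ss) = trans (endpoint-Step v e s) (endpoint-↠ v e ss)

  endpoint-homotopic : (v : V C) (e : map p v ≡ x) {M M′ : Walk G x y} →
                       Homotopic M M′ → endpoint v e M ≡ endpoint v e M′
  endpoint-homotopic v e (_ , (M↠R , _) , (M′↠R , _)) = trans (endpoint-↠ v e M↠R) (≡.sym (endpoint-↠ v e M′↠R))

length-mapW : ∀ {C G : Graph} (p : Covering C G) {u v} (W : Walk C u v) → length (mapW p W) ≡ length W
length-mapW p nil        = refl
length-mapW p (cons _ W) = cong suc (length-mapW p W)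

length-subst : ∀ {G : Graph} {x y z} (h : y ≡ z) (W : Walk G x y) → length (subst (Walk G x) h W) ≡ length W
length-subst refl W = refl

local-covering-LiftCloses : ∀ {k G x0 C} {p : Covering C G} → IsLocalCovering k G x0 C p →
  Σ[ x̂ ∈ V C ] Σ[ e ∈ map p x̂ ≡ x0 ] (∀ W → LiftCloses p x̂ e W ⇔ InLocal k W)
local-covering-LiftCloses {k} {p = p} (_ , x̂ , refl , _ , lifts , projects) =
  x̂ , refl , λ W → mk⇔ (to W) (from W)
  where
  to : ∀ W → LiftCloses p x̂ refl W → InLocal k W
  to W closes with closed-lift p x̂ W closes
  ... | Ŵ , refl = projects Ŵ
  from : ∀ W → InLocal k W → LiftCloses p x̂ refl W
  from W i with lifts W i
  ... | Ŵ , Ŵ≃W = trans (≡.sym (endpoint-homotopic p x̂ refl Ŵ≃W)) (endpoint-mapW p Ŵ)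

module _ (lem : ExcludedMiddle 0ℓ) {C G : Graph} (p : Covering C G) {ρ : ℕ} where

  -- Project a short walk W between lifts u, v of one vertex to a closed walk M; conjugated by the projection
  -- of a path from x̂ to u it lies in π₁^ρ, so the lift of M at u, which ends at v, closes.
  LiftCloses⇒DisplacementGt : ∀ {x0} → Connected C → (x̂ : V C) (e : map p x̂ ≡ x0) →
    (∀ W → InLocal ρ W → LiftCloses p x̂ e W) → DisplacementGt p ρ
  LiftCloses⇒DisplacementGt connected x̂ refl closes u v same-image u≢v W = ≰⇒> W-not-short
    where
    W-not-short : ¬ length W ≤ ρ
    W-not-short W≤ρ = u≢v (begin
      u                                         ≡⟨ ≡.sym A-ends-at-u ⟩
      û                                         ≡⟨ ≡.sym M-closes-at-û ⟩
      endpoint p û (endpoint-over p x̂ refl A) M ≡⟨ endpoint-cong p A-ends-at-u _ refl M ⟩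
      endpoint p u refl M                       ≡⟨ endpoint-subst p refl (≡.sym same-image) (mapW p W) ⟩
      endpoint p u refl (mapW p W)              ≡⟨ endpoint-mapW p W ⟩
      v                                         ∎)
      where
      open ≡-Reasoning
      A : Walk G (map p x̂) (map p u)
      A = mapW p (connected x̂ u)
      û : V C
      û = endpoint p x̂ refl A
      A-ends-at-u : û ≡ u
      A-ends-at-u = endpoint-mapW p (connected x̂ u)
      M : Walk G (map p u) (map p u)
      M = subst (Walk G (map p u)) (≡.sym same-image) (mapW p W)
      M≤ρ : length M ≤ ρ
      M≤ρ = subst (_≤ ρ) (≡.sym (trans (length-subst _ (mapW p W)) (length-mapW p W))) W≤ρ
      M-closes-at-û : LiftCloses p û (endpoint-over p x̂ refl A) M
      M-closes-at-û =
        Equivalence.to (LiftCloses-conjugate p x̂ refl A M) (closes _ (conjugate-InLocal lem M M≤ρ A))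

  DisplacementGt⇒short-LiftCloses : DisplacementGt p ρ → ∀ {y} (v : V C) (e : map p v ≡ y) (M : Walk G y y) →
                                    length M ≤ ρ → LiftCloses p v e M
  DisplacementGt⇒short-LiftCloses Δ>ρ v e M M≤ρ with lem {LiftCloses p v e M}
  ... | yes closes    = closes
  ... | no not-closed =
    ⊥-elim (<⇒≱ (Δ>ρ v (endpoint p v e M) (trans e (≡.sym (endpoint-over p v e M)))
                    (not-closed ∘ ≡.sym) (lift p v e M))
                (subst (_≤ ρ) (≡.sym (length-lift p v e M)) M≤ρ))

  DisplacementGt⇒InLocal-LiftCloses : DisplacementGt p ρ → ∀ {x0} {W : Walk G x0 x0} → InLocal ρ W →
                                      ∀ v (e : map p v ≡ x0) → LiftCloses p v e W
  DisplacementGt⇒InLocal-LiftCloses Δ>ρ = closes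
    where
    closes : ∀ {x0} {W : Walk G x0 x0} → InLocal ρ W → ∀ v (e : map p v ≡ x0) → LiftCloses p v e W
    closes (gen (_ , W0 , Q , _ , Q≤ρ , refl)) v e =
      Equivalence.from (LiftCloses-conjugate p v e W0 Q) (DisplacementGt⇒short-LiftCloses Δ>ρ _ _ Q Q≤ρ)
    closes unit v e = refl
    closes (mul {W} {W′} i j) v e =
      trans (endpoint-++ p v e W W′) (trans (endpoint-cong p (closes i v e) _ e W′) (closes j v e))
    closes (inv {W} i) v e =
      trans (endpoint-cong p (≡.sym (closes i v e)) e (endpoint-over p v e W) (rev W)) (endpoint-rev p v e W)
    closes (homot W≃W′ i) v e = trans (≡.sym (endpoint-homotopic p v e W≃W′)) (closes i v e)

DisplacementGt⇔InLocal-⊆ : ExcludedMiddle 0ℓ → ∀ {r G x0 C} {p : Covering C G} → IsLocalCovering r G x0 C p →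
  ∀ ρ → DisplacementGt p ρ ⇔ (∀ (W : Walk G x0 x0) → InLocal ρ W → InLocal r W)
DisplacementGt⇔InLocal-⊆ lem {p = p} lc ρ with local-covering-LiftCloses lc
... | x̂ , e , closes⇔local = mk⇔
  (λ Δ>ρ W i → Equivalence.to (closes⇔local W) (DisplacementGt⇒InLocal-LiftCloses lem p Δ>ρ i x̂ e))
  (λ ⊆ → LiftCloses⇒DisplacementGt lem p (proj₁ lc) x̂ e (λ W i → Equivalence.from (closes⇔local W) (⊆ W i)))

local-covering-DisplacementGt : ExcludedMiddle 0ℓ → ∀ {k G x0 C} {p : Covering C G} →
                                IsLocalCovering k G x0 C p → DisplacementGt p k
local-covering-DisplacementGt lem {k} lc = Equivalence.from (DisplacementGt⇔InLocal-⊆ lem lc k) (λ W i → i)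

module Transfer {C D G : Graph} (p : Covering C G) (q : Covering D G) {x0 : V G} {c : V C} {d : V D}
  (c-over : map p c ≡ x0) (d-over : map q d ≡ x0) (C-connected : Connected C)
  (closes : ∀ W → LiftCloses p c c-over W → LiftCloses q d d-over W) where

  route : (u : V C) → Walk G x0 (map p u)
  route u = subst (λ x → Walk G x (map p u)) c-over (mapW p (C-connected c u))

  route-lifts : ∀ u → endpoint p c c-over (route u) ≡ u
  route-lifts u = lifts c-over
    where
    lifts : ∀ {x} (e : map p c ≡ x) →
            endpoint p c e (subst (λ x → Walk G x (map p u)) e (mapW p (C-connected c u))) ≡ u
    lifts refl = endpoint-mapW p (C-connected c u)

  transfer : V C → V D
  transfer u = endpoint q d d-over (route u)

  transfer-over : ∀ u → map q (transfer u) ≡ map p u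
  transfer-over u = endpoint-over q d d-over (route u)

  -- R and M lift from c to the same vertex of C, so the lift of R M⁻ closes in C, hence in D.
  endpoint-transfer : ∀ {z} (M : Walk G x0 z) → endpoint q d d-over M ≡ transfer (endpoint p c c-over M)
  endpoint-transfer {z} M = trans (≡.sym same-in-D) (endpoint-subst q d-over (endpoint-over p c c-over M) (route u))
    where
    u : V C
    u = endpoint p c c-over M
    R : Walk G x0 z
    R = subst (Walk G x0) (endpoint-over p c c-over M) (route u)
    same-in-C : endpoint p c c-over R ≡ endpoint p c c-over M
    same-in-C = trans (endpoint-subst p c-over (endpoint-over p c c-over M) (route u)) (route-lifts u)
    same-in-D : endpoint q d d-over R ≡ endpoint q d d-over M
    same-in-D = Equivalence.from (endpoint-≡⇔LiftCloses q d d-over R M)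
                  (closes (R ++ʷ rev M) (Equivalence.to (endpoint-≡⇔LiftCloses p c c-over R M) same-in-C))

  transfer-adj : ∀ {u v} → Adj C u v → Adj D (transfer u) (transfer v)
  transfer-adj {u} {v} b =
    subst (Adj D (transfer u))
      (trans (≡.sym (endpoint-++ q d d-over (route u) edge))
             (trans (endpoint-transfer M) (cong transfer M-lifts-to-v)))
      (endpoint-edge-adj q (transfer u) (transfer-over u) (hom p b))
    where
    edge : Walk G (map p u) (map p v)
    edge = cons (hom p b) nil
    M : Walk G x0 (map p v)
    M = route u ++ʷ edge
    M-lifts-to-v : endpoint p c c-over M ≡ v
    M-lifts-to-v =
      trans (endpoint-++ p c c-over (route u) edge)
        (trans (endpoint-cong p (route-lifts u) (endpoint-over p c c-over (route u)) refl edge)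
               (endpoint-edge-unique p u refl (hom p b) b refl))

LiftCloses⇔⇒IsoCoverings : ∀ {C D G : Graph} {p : Covering C G} {q : Covering D G} {x0 c d} →
  Connected C → Connected D → (c-over : map p c ≡ x0) (d-over : map q d ≡ x0) →
  (∀ W → LiftCloses p c c-over W ⇔ LiftCloses q d d-over W) → IsoCoverings p q
LiftCloses⇔⇒IsoCoverings {C = C} {p = p} {q = q} C-connected D-connected c-over d-over same-closing =
  φ.transfer , ψ.transfer , ψφ , φψ , φ.transfer-adj ,
  (λ a → subst₂ (Adj C) (ψφ _) (ψφ _) (ψ.transfer-adj a)) , φ.transfer-over
  where
  module φ = Transfer p q c-over d-over C-connected (Equivalence.to ∘ same-closing)
  module ψ = Transfer q p d-over c-over D-connected (Equivalence.from ∘ same-closing)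
  ψφ : ∀ u → ψ.transfer (φ.transfer u) ≡ u
  ψφ u = trans (≡.sym (ψ.endpoint-transfer (φ.route u))) (φ.route-lifts u)
  φψ : ∀ w → φ.transfer (ψ.transfer w) ≡ w
  φψ w = trans (≡.sym (φ.endpoint-transfer (ψ.route w))) (ψ.route-lifts w)

module _ {C D : Graph} (f : V C → V D) (f-adj : ∀ {u v} → Adj C u v → Adj D (f u) (f v)) where

  mapWalk : ∀ {u v} → Walk C u v → Walk D (f u) (f v)
  mapWalk nil        = nil
  mapWalk (cons a W) = cons (f-adj a) (mapWalk W)

  length-mapWalk : ∀ {u v} (W : Walk C u v) → length (mapWalk W) ≡ length W
  length-mapWalk nil        = refl
  length-mapWalk (cons _ W) = cong suc (length-mapWalk W)

IsoCoverings-DisplacementGt : ∀ {C D G : Graph} {p : Covering C G} {q : Covering D G} {ρ} →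
                              IsoCoverings p q → DisplacementGt q ρ → DisplacementGt p ρ
IsoCoverings-DisplacementGt {ρ = ρ} (φ , ψ , ψφ , _ , φ-adj , _ , φ-over) Δ>ρ u v same-image u≢v W =
  subst (ρ <_) (length-mapWalk φ φ-adj W)
    (Δ>ρ (φ u) (φ v) (trans (φ-over u) (trans same-image (≡.sym (φ-over v))))
         (λ φu≡φv → u≢v (trans (≡.sym (ψφ u)) (trans (cong ψ φu≡φv) (ψφ v))))
         (mapWalk φ φ-adj W))

DisplacementGt⇔IsoCoverings : ExcludedMiddle 0ℓ → ∀ {r ρ G x0 C D} {p : Covering C G} {q : Covering D G} →
  IsLocalCovering r G x0 C p → IsLocalCovering ρ G x0 D q → r ≤ ρ → DisplacementGt p ρ ⇔ IsoCoverings p q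
DisplacementGt⇔IsoCoverings lem {ρ = ρ} {p = p} {q = q} lcp lcq r≤ρ
  with local-covering-LiftCloses lcp | local-covering-LiftCloses lcq
... | x̂ , e , p-closes⇔local | x̃ , ẽ , q-closes⇔local = mk⇔ to from
  where
  to : DisplacementGt p ρ → IsoCoverings p q
  to Δ>ρ = LiftCloses⇔⇒IsoCoverings (proj₁ lcp) (proj₁ lcq) e ẽ λ W →
    ⇔.trans (p-closes⇔local W)
      (⇔.trans (mk⇔ (InLocal-mono r≤ρ) (Equivalence.to (DisplacementGt⇔InLocal-⊆ lem lcp ρ) Δ>ρ W))
               (⇔.sym (q-closes⇔local W)))
  from : IsoCoverings p q → DisplacementGt p ρ
  from iso = IsoCoverings-DisplacementGt {p = p} {q = q} iso (local-covering-DisplacementGt lem lcq)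

m+m≤o⇒n+n≤o⇒m+n≤o : ∀ {m n o} → m + m ≤ o → n + n ≤ o → m + n ≤ o
m+m≤o⇒n+n≤o⇒m+n≤o {m} {n} m+m≤o n+n≤o with ≤-total m n
... | inj₁ m≤n = ≤-trans (+-mono-≤ m≤n ≤-refl) n+n≤o
... | inj₂ n≤m = ≤-trans (+-mono-≤ ≤-refl n≤m) m+m≤o

module _ {G : Graph} where

  private variable
    a b u v x y : V G

  head∈verts : (W : Walk G x y) → x ∈ verts W
  head∈verts nil        = here refl
  head∈verts (cons _ _) = here refl

  Traverses⇒Adj : {W : Walk G x y} → Traverses {a = a} {b = b} W → Adj G a b
  Traverses⇒Adj (here⃗ e _) = e
  Traverses⇒Adj (here⃖ e _) = sym G e
  Traverses⇒Adj (there _ t) = Traverses⇒Adj t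

  Traverses⇒∈ˡ : {W : Walk G x y} → Traverses {a = a} {b = b} W → a ∈ verts W
  Traverses⇒∈ˡ (here⃗ _ _) = here refl
  Traverses⇒∈ˡ (here⃖ _ W) = there (head∈verts W)
  Traverses⇒∈ˡ (there _ t) = there (Traverses⇒∈ˡ t)

  Traverses⇒∈ʳ : {W : Walk G x y} → Traverses {a = a} {b = b} W → b ∈ verts W
  Traverses⇒∈ʳ (here⃗ _ W) = there (head∈verts W)
  Traverses⇒∈ʳ (here⃖ _ _) = here refl
  Traverses⇒∈ʳ (there _ t) = there (Traverses⇒∈ʳ t)

  Traverses-subst : {h : y ≡ b} {W : Walk G x y} {s t : V G} →
                    Traverses {a = s} {b = t} W → Traverses {a = s} {b = t} (subst (Walk G x) h W)
  Traverses-subst {h = refl} t = t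

  -- Of the two arcs of W between v and u, take the shorter.
  walk-from-visited : (W : Walk G v v) → u ∈ verts W → Σ[ X ∈ Walk G u v ] length X + length X ≤ length W
  walk-from-visited W u∈W with ∈-verts⇒split W u∈W
  ... | P , S , refl with ≤-total (length S) (length P)
  ...   | inj₁ S≤P rewrite length-++ P S = S , +-mono-≤ S≤P ≤-refl
  ...   | inj₂ P≤S rewrite length-++ P S =
    rev P , subst (λ n → n + n ≤ length P + length S) (≡.sym (length-rev P)) (+-mono-≤ ≤-refl P≤S)

  ball-join : ∀ {ρ u′} → InBallV G v ρ u → InBallV G v ρ u′ → Σ[ X ∈ Walk G u u′ ] length X ≤ ρ
  ball-join (W , W≤ρ , u∈W) (W′ , W′≤ρ , u′∈W′) with walk-from-visited W u∈W | walk-from-visited W′ u′∈W′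
  ... | X , X≤W | X′ , X′≤W′ =
    X ++ʷ rev X′ ,
    subst (_≤ _) (≡.sym (trans (length-++ X (rev X′)) (cong (length X +_) (length-rev X′))))
      (m+m≤o⇒n+n≤o⇒m+n≤o {length X} {length X′} (≤-trans X≤W W≤ρ) (≤-trans X′≤W′ W′≤ρ))

module _ {C G : Graph} (p : Covering C G) where

  private variable
    u v : V C

  ∈-mapW : {u : V C} (W : Walk C v u) {w : V C} → w ∈ verts W → map p w ∈ verts (mapW p W)
  ∈-mapW nil        (here refl) = here refl
  ∈-mapW (cons _ W) (here refl) = here refl
  ∈-mapW (cons _ W) (there w∈W) = there (∈-mapW W w∈W)

  ∈-mapW⁻ : (W : Walk C v u) {y : V G} → y ∈ verts (mapW p W) → Σ[ w ∈ V C ] (w ∈ verts W × map p w ≡ y)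
  ∈-mapW⁻ nil        (here refl) = _ , here refl , refl
  ∈-mapW⁻ (cons _ W) (here refl) = _ , here refl , refl
  ∈-mapW⁻ (cons _ W) (there y∈W) with ∈-mapW⁻ W y∈W
  ... | w , w∈W , w-over = w , there w∈W , w-over

  Traverses-mapW : (W : Walk C v u) {a b : V C} → Traverses {a = a} {b = b} W →
                   Traverses {a = map p a} {b = map p b} (mapW p W)
  Traverses-mapW (cons _ W) (here⃗ e _) = here⃗ (hom p e) (mapW p W)
  Traverses-mapW (cons _ W) (here⃖ e _) = here⃖ (hom p e) (mapW p W)
  Traverses-mapW (cons _ W) (there e t) = there (hom p e) (Traverses-mapW W t)

  Traverses-mapW⁻ : (W : Walk C v u) {s t : V G} → Traverses {a = s} {b = t} (mapW p W) →
    Σ[ a ∈ V C ] Σ[ b ∈ V C ] (Traverses {a = a} {b = b} W × map p a ≡ s × map p b ≡ t)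
  Traverses-mapW⁻ (cons e W) (here⃗ _ _) = _ , _ , here⃗ e W , refl , refl
  Traverses-mapW⁻ (cons e W) (here⃖ _ _) = _ , _ , here⃖ e W , refl , refl
  Traverses-mapW⁻ (cons e W) (there _ t) with Traverses-mapW⁻ W t
  ... | a , b , t′ , a-over , b-over = a , b , there e t′ , a-over , b-over

  private
    mapW-≤ : ∀ {ρ} (W : Walk C v u) → length W ≤ ρ → length (mapW p W) ≤ ρ
    mapW-≤ W = subst (_≤ _) (≡.sym (length-mapW p W))

  DisplacementGt⇒PreservesBalls : ExcludedMiddle 0ℓ → ∀ {ρ} → DisplacementGt p ρ → PreservesBalls p ρ
  DisplacementGt⇒PreservesBalls lem {ρ} Δ>ρ v =
    (λ _ (W , W≤ρ , u∈W) → mapW p W , mapW-≤ W W≤ρ , ∈-mapW W u∈W) ,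
    (λ _ _ (W , W≤ρ , t) → mapW p W , mapW-≤ W W≤ρ , Traverses-mapW W t) ,
    injective , vertex-surjective , edge-surjective
    where
    injective : ∀ u u′ → InBallV C v ρ u → InBallV C v ρ u′ → map p u ≡ map p u′ → u ≡ u′
    injective u u′ u∈B u′∈B same-image with lem {u ≡ u′}
    ... | yes u≡u′ = u≡u′
    ... | no  u≢u′ with ball-join u∈B u′∈B
    ...   | X , X≤ρ = ⊥-elim (<⇒≱ (Δ>ρ u u′ same-image u≢u′ X) X≤ρ)

    lift-closed : (M : Walk G (map p v) (map p v)) → length M ≤ ρ → Σ[ Ŵ ∈ Walk C v v ] mapW p Ŵ ≡ M
    lift-closed M M≤ρ = closed-lift p v M (DisplacementGt⇒short-LiftCloses lem p Δ>ρ v refl M M≤ρ)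

    vertex-surjective : ∀ y → InBallV G (map p v) ρ y → Σ[ u ∈ V C ] (InBallV C v ρ u × map p u ≡ y)
    vertex-surjective y (M , M≤ρ , y∈M) with lift-closed M M≤ρ
    ... | Ŵ , refl with ∈-mapW⁻ Ŵ y∈M
    ...   | u , u∈Ŵ , u-over = u , (Ŵ , subst (_≤ ρ) (length-mapW p Ŵ) M≤ρ , u∈Ŵ) , u-over

    edge-surjective : ∀ s t → InBallE G (map p v) ρ s t →
      Σ[ a ∈ V C ] Σ[ b ∈ V C ] (InBallE C v ρ a b × map p a ≡ s × map p b ≡ t)
    edge-surjective s t (M , M≤ρ , st∈M) with lift-closed M M≤ρ
    ... | Ŵ , refl with Traverses-mapW⁻ Ŵ st∈M
    ...   | a , b , ab∈Ŵ , a-over , b-over =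
      a , b , (Ŵ , subst (_≤ ρ) (length-mapW p Ŵ) M≤ρ , ab∈Ŵ) , a-over , b-over

  -- Each edge of X is the lift inside the ball of its projection, by injectivity on the ball and
  -- uniqueness of edge lifts.
  walk-stays-in-ball : ∀ {ρ} → PreservesBalls p ρ → ∀ v {a b} (X : Walk C a b) → InBallV C v ρ a →
    (∀ {s t} → Traverses {a = s} {b = t} (mapW p X) → InBallE G (map p v) ρ s t) → InBallV C v ρ b
  walk-stays-in-ball pb v nil a∈B _ = a∈B
  walk-stays-in-ball {ρ} pb v {a} (cons {y = a′} e X) a∈B edges∈B with pb v
  ... | _ , _ , injective , _ , edge-surjective
    with edge-surjective _ _ (edges∈B (here⃗ (hom p e) (mapW p X)))
  ...   | a₁ , b₁ , (W , W≤ρ , a₁b₁∈W) , a₁-over , b₁-over =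
    walk-stays-in-ball pb v X a′∈B (edges∈B ∘ there (hom p e))
    where
    a₁≡a : a₁ ≡ a
    a₁≡a = injective a₁ a (W , W≤ρ , Traverses⇒∈ˡ a₁b₁∈W) a∈B a₁-over
    a′≡b₁ : a′ ≡ b₁
    a′≡b₁ = liftE-uniq p a e (subst (λ z → Adj C z b₁) a₁≡a (Traverses⇒Adj a₁b₁∈W)) (≡.sym b₁-over)
    a′∈B : InBallV C v ρ a′
    a′∈B = subst (InBallV C v ρ) (≡.sym a′≡b₁) (W , W≤ρ , Traverses⇒∈ʳ a₁b₁∈W)

  PreservesBalls⇒DisplacementGt : ∀ {ρ} → PreservesBalls p ρ → DisplacementGt p ρ
  PreservesBalls⇒DisplacementGt {ρ} pb u v same-image u≢v W with pb u
  ... | _ , _ , injective , _ , _ = ≰⇒> W-not-short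
    where
    u∈B : InBallV C u ρ u
    u∈B = nil , z≤n , here refl
    W-not-short : ¬ length W ≤ ρ
    W-not-short W≤ρ = u≢v (injective u v u∈B v∈B same-image)
      where
      M : Walk G (map p u) (map p u)
      M = subst (Walk G (map p u)) (≡.sym same-image) (mapW p W)
      M≤ρ : length M ≤ ρ
      M≤ρ = subst (_≤ ρ) (≡.sym (trans (length-subst _ (mapW p W)) (length-mapW p W))) W≤ρ
      v∈B : InBallV C u ρ v
      v∈B = walk-stays-in-ball pb u W u∈B (λ st∈W → M , M≤ρ , Traverses-subst st∈W)

DisplacementGt⇔PreservesBalls : ExcludedMiddle 0ℓ → ∀ {C G} (p : Covering C G) ρ →
                                DisplacementGt p ρ ⇔ PreservesBalls p ρ
DisplacementGt⇔PreservesBalls lem p ρ = mk⇔ (DisplacementGt⇒PreservesBalls p lem) (PreservesBalls⇒DisplacementGt p)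

m<n⇒m≤n∸1 : ∀ {m n} → m < n → m ≤ n ∸ 1
m<n⇒m≤n∸1 (s≤s m≤n) = m≤n

m≤n⇒m∸1<n : ∀ {m n} → 0 < m → m ≤ n → m ∸ 1 < n
m≤n⇒m∸1<n {suc _} _ m≤n = m≤n

least-witness : ExcludedMiddle 0ℓ → {P : ℕ → Set} → ∀ {n} → P n → Σ[ m ∈ ℕ ] (P m × (∀ k → P k → m ≤ k))
least-witness lem {P} {n} Pn = go n (<-wellFounded n) Pn
  where
  go : ∀ n → Acc _<_ n → P n → Σ[ m ∈ ℕ ] (P m × (∀ k → P k → m ≤ k))
  go n (acc smaller) Pn with lem {Σ[ k ∈ ℕ ] (P k × k < n)}
  ... | yes (k , Pk , k<n) = go k (smaller k<n) Pk
  ... | no  none           = n , Pn , λ k Pk → ≮⇒≥ (λ k<n → none (k , Pk , k<n))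

walk-between-distinct-nonempty : ∀ {G : Graph} {u v} → u ≢ v → (W : Walk G u v) → 0 < length W
walk-between-distinct-nonempty u≢v nil        = ⊥-elim (u≢v refl)
walk-between-distinct-nonempty u≢v (cons _ _) = s≤s z≤n

module _ {C G : Graph} (p : Covering C G) where

  DisplacedPairAt : ℕ → Set
  DisplacedPairAt n =
    Σ[ u ∈ V C ] Σ[ v ∈ V C ] (map p u ≡ map p v × u ≢ v × Σ[ W ∈ Walk C u v ] length W ≡ n)

  displacement : ExcludedMiddle 0ℓ → Connected C → DisplacementIs p ∞ ⊎ Σ[ n ∈ ℕ ] DisplacementIs p (fin n)
  displacement lem connected with lem {Σ[ u ∈ V C ] Σ[ v ∈ V C ] (map p u ≡ map p v × u ≢ v)}
  ... | no no-pair = inj₁ λ u v same-image → decide u v same-image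
    where
    decide : ∀ u v → map p u ≡ map p v → u ≡ v
    decide u v same-image with lem {u ≡ v}
    ... | yes u≡v = u≡v
    ... | no  u≢v = ⊥-elim (no-pair (u , v , same-image , u≢v))
  ... | yes (u , v , same-image , u≢v)
    with least-witness lem {DisplacedPairAt} (u , v , same-image , u≢v , connected u v , refl)
  ...   | n , displaced , minimal =
    inj₂ (n , displaced , λ a b same-image a≢b W → minimal (length W) (a , b , same-image , a≢b , W , refl))

  DisplacementIs-∞⇒Gt : DisplacementIs p ∞ → ∀ ρ → DisplacementGt p ρ
  DisplacementIs-∞⇒Gt Δ≡∞ ρ u v same-image u≢v _ = ⊥-elim (u≢v (Δ≡∞ u v same-image))

  DisplacementIs-fin⇒Gt : ∀ {n} → DisplacementIs p (fin n) → DisplacementGt p (n ∸ 1)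
  DisplacementIs-fin⇒Gt ((_ , _ , _ , u≢v , W , refl) , minimal) a b same-image a≢b V =
    m≤n⇒m∸1<n (walk-between-distinct-nonempty u≢v W) (minimal a b same-image a≢b V)

  DisplacementIs-fin-Gt⇒≤ : ∀ {n ρ} → DisplacementIs p (fin n) → DisplacementGt p ρ → ρ ≤ n ∸ 1
  DisplacementIs-fin-Gt⇒≤ ((u , v , same-image , u≢v , W , refl) , _) Δ>ρ =
    m<n⇒m≤n∸1 (Δ>ρ u v same-image u≢v W)

lemma5p2 : ExcludedMiddle 0ℓ →
    (G : Graph) → Connected G → (r : ℕ) → (x0 : V G) →
    (Cr : Graph) (pr : Covering Cr G) → IsLocalCovering r G x0 Cr pr →
    (∀ (ρ : ℕ) → r ≤ ρ → (Cρ : Graph) (pρ : Covering Cρ G) → IsLocalCovering ρ G x0 Cρ pρ →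
        (Cond-i x0 r pr ρ ⇔ Cond-ii x0 r pr ρ)
      × (Cond-i x0 r pr ρ ⇔ Cond-iii x0 r pr ρ)
      × (Cond-i x0 r pr ρ ⇔ Cond-iv x0 r pr ρ pρ))
    ×
    ((DisplacementIs pr ∞ × (∀ (ρ : ℕ) → r ≤ ρ → AllHold x0 r pr ρ))
     ⊎ (Σ[ n ∈ ℕ ] (DisplacementIs pr (fin n)
         × r ≤ n ∸ 1
         × AllHold x0 r pr (n ∸ 1)
         × (∀ (ρ : ℕ) → r ≤ ρ → AllHold x0 r pr ρ → ρ ≤ n ∸ 1))))
lemma5p2 lem G _ r x0 Cr pr lcr =
  (λ ρ r≤ρ _ _ lcρ → DisplacementGt⇔PreservesBalls lem pr ρ , DisplacementGt⇔InLocal-⊆ lem lcr ρ ,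
                     DisplacementGt⇔IsoCoverings lem lcr lcρ r≤ρ) ,
  Sum.map
    (λ Δ≡∞ → Δ≡∞ , λ ρ r≤ρ → all-hold ρ r≤ρ (DisplacementIs-∞⇒Gt pr Δ≡∞ ρ))
    (λ (n , Δ≡n) →
      let r≤n∸1 = DisplacementIs-fin-Gt⇒≤ pr Δ≡n (local-covering-DisplacementGt lem lcr)
      in n , Δ≡n , r≤n∸1 , all-hold (n ∸ 1) r≤n∸1 (DisplacementIs-fin⇒Gt pr Δ≡n) ,
         λ ρ _ (Δ>ρ , _) → DisplacementIs-fin-Gt⇒≤ pr Δ≡n Δ>ρ)
    (displacement pr lem (proj₁ lcr))
  where
  all-hold : ∀ ρ → r ≤ ρ → Cond-i x0 r pr ρ → AllHold x0 r pr ρ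
  all-hold ρ r≤ρ Δ>ρ =
    Δ>ρ , Equivalence.to (DisplacementGt⇔PreservesBalls lem pr ρ) Δ>ρ ,
    Equivalence.to (DisplacementGt⇔InLocal-⊆ lem lcr ρ) Δ>ρ ,
    λ _ _ lcρ → Equivalence.to (DisplacementGt⇔IsoCoverings lem lcr lcρ r≤ρ) Δ>ρ
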